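{- For every integer $n\geq 5$, \[ mis(C_n)\geq \ell\left(\left\lfloor \tfrac{n+1}{2}\right\rfloor\right), \] where $C_n$ is the cycle on $n$ vertices.
   Context: $mis(G)$ denotes the number of maximal independent sets (independent sets not properly contained in another independent set) of a graph $G$. $f(n)$ denotes the $n$th Fibonacci number: $f(0)=0$, $f(1)=1$, $f(n)=f(n-1)+f(n-2)$ for $n\ge 2$. For $n\geq 3$, $\ell(n)=f(n+2)-f(n-3)$. -}

module Defs where

open import Data.Nat using (ℕ; zero; suc; _+_; _∸_)
import Data.Nat.Properties as ℕP
open import Data.Fin using (Fin; toℕ)
open import Data.Fin.Subset using (Subset; _∈_; _∉_)
open import Data.Fin.Subset.Properties using (_∈?_)
open import Data.Fin.Properties using (all?; any?)
open import Data.Vec using (Vec; []; _∷_)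
open import Data.Bool using (Bool; true; false)
open import Data.List using (List; []; _∷_; map; filter; length; concatMap)
open import Data.Product using (_×_; Σ; ∃-syntax; _,_)
open import Data.Sum using (_⊎_)
open import Relation.Nullary using (¬_; Dec; yes; no)
open import Relation.Nullary.Decidable using (_×-dec_; ¬?; _⊎-dec_; _→-dec_)
open import Relation.Binary.PropositionalEquality using (_≡_)

fib : ℕ → ℕ
fib zero = 0
fib (suc zero) = 1
fib (suc (suc n)) = fib (suc n) + fib n

-- ℓ(n) = f(n+2) - f(n-3), intended for n ≥ 3.
ℓ : ℕ → ℕ
ℓ n = fib (n + 2) ∸ fib (n ∸ 3)

record Graph (n : ℕ) : Set₁ where
  field
    Adj  : Fin n → Fin n → Set
    adj? : ∀ i j → Dec (Adj i j)

open Graph public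

-- Cycle C_n on vertices 0,…,n-1: i ~ j iff j = i+1, or i = j+1,
-- or {i,j} = {0, n-1}.  For n ≥ 3 this is the n-cycle.
CycleAdj : (n : ℕ) → Fin n → Fin n → Set
CycleAdj n i j =
  (toℕ j ≡ suc (toℕ i)) ⊎ (toℕ i ≡ suc (toℕ j))
  ⊎ ((toℕ i ≡ 0) × (toℕ j ≡ n ∸ 1)) ⊎ ((toℕ j ≡ 0) × (toℕ i ≡ n ∸ 1))

C : (n : ℕ) → Graph n
C n = record
  { Adj = CycleAdj n
  ; adj? = λ i j →
      (toℕ j ℕP.≟ suc (toℕ i)) ⊎-dec (toℕ i ℕP.≟ suc (toℕ j))
      ⊎-dec ((toℕ i ℕP.≟ 0) ×-dec (toℕ j ℕP.≟ n ∸ 1))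
      ⊎-dec ((toℕ j ℕP.≟ 0) ×-dec (toℕ i ℕP.≟ n ∸ 1))
  }

module _ {n : ℕ} (G : Graph n) where

  Independent : Subset n → Set
  Independent S = ∀ i j → i ∈ S → j ∈ S → ¬ Adj G i j

  -- S is a maximal independent set: independent, and every vertex outside S
  -- has a neighbour in S (equivalently, S ∪ {v} is not independent for v ∉ S).
  MaximalIndependent : Subset n → Set
  MaximalIndependent S =
    Independent S × (∀ v → v ∉ S → ∃[ u ] (u ∈ S × Adj G v u))

  independent? : ∀ S → Dec (Independent S)
  independent? S = all? λ i → all? λ j →
    (i ∈? S) →-dec ((j ∈? S) →-dec ¬? (adj? G i j))

  maximalIndependent? : ∀ S → Dec (MaximalIndependent S)
  maximalIndependent? S = independent? S ×-dec
    (all? λ v → ¬? (v ∈? S) →-dec any? λ u → (u ∈? S) ×-dec adj? G v u)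

allSubsets : (n : ℕ) → List (Subset n)
allSubsets zero = [] ∷ []
allSubsets (suc n) = concatMap (λ S → (false ∷ S) ∷ (true ∷ S) ∷ []) (allSubsets n)

mis : {n : ℕ} → Graph n → ℕ
mis {n} G = length (filter (maximalIndependent? G) (allSubsets n))

{-# OPTIONS --safe #-}
-- A set of vertices of the cycle is maximal independent as soon as its characteristic
-- word, read cyclically, has no factor 11 and no factor 000; equivalently, an automaton
-- tracking the trailing run of zeros survives the word followed by its first two letters.
-- Splitting by those two letters, the number c n of such words is a sum of shifts of
-- sequences with a (k + 3) = a (k + 1) + a k. Hence c obeys this recurrence from index 3
-- on, and c (n + 5) = c (n + 4) + c n makes it nondecreasing from 5 on. Since
-- ℓ (j + 2) = ℓ (j + 1) + ℓ j for j ≥ 3, the step c (n + 4) = c (n + 2) + c (n + 1) ≥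
-- c (n + 2) + c n dominates one step of ℓ, and ℓ ⌊(n + 1)/2⌋ ≤ c n ≤ mis (C n) reduces
-- to the cases n = 5, 6, 7, 8.
module Submission where

open import Defs
open import Data.Nat using (ℕ; _≤_; _+_; _/_)
open import Data.Nat using (zero; suc; _<_; _∸_; _*_; s≤s; z≤n)
open import Data.Nat.Properties
  using ( _≟_; +-suc; +-comm; +-identityʳ; +-commutativeSemigroup; +-mono-≤; +-monoʳ-≤
        ; ≤-refl; ≤-reflexive; ≤-trans; ≤-pred; <⇒≤; ≤∧≢⇒<; n≤1+n; m≤m+n; ≤ᵇ⇒≤
        ; ∸-+-assoc; +-∸-comm; +-∸-assoc; m≤n⇒∃[o]m+o≡n; module ≤-Reasoning )
open import Data.Nat.Divisibility using (divides-refl)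
open import Data.Nat.DivMod using (+-distrib-/-∣ˡ; m*n/n≡m)
open import Algebra.Properties.CommutativeSemigroup +-commutativeSemigroup using (interchange)
open import Data.Bool using (Bool; true; false)
open import Data.Fin using (toℕ) renaming (zero to fzero; suc to fsuc)
open import Data.Fin.Properties using (toℕ<n)
open import Data.Fin.Subset using (_∈_; _∉_)
open import Data.Vec using (Vec; []; _∷_; _++_; here; there)
open import Data.List using (List; filter; length; concatMap) renaming ([] to []ˡ; _∷_ to _∷ˡ_)
open import Data.List.Properties using (filter-none)
open import Data.List.Relation.Unary.All using (universal)
open import Data.List.Relation.Binary.Sublist.Propositional using (⊆-refl)
open import Data.List.Relation.Binary.Sublist.Propositional.Properties using (filter⁺; length-mono-≤)
open import Data.Product using (_×_; _,_; ∃-syntax)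
open import Data.Sum using (_⊎_; inj₁; inj₂)
open import Data.Empty using (⊥)
open import Function using (_∘_)
open import Relation.Nullary using (¬_; yes; no; does; contradiction)
open import Relation.Unary using (Pred; Decidable)
open import Relation.Binary.PropositionalEquality
  using (_≡_; _≗_; refl; sym; trans; cong; cong₂; subst; module ≡-Reasoning)

-- Dies exactly at the first factor 11 or 000 of the word read.
data State : Set where
  start ends1 ends0 ends00 dead : State

step : State → Bool → State
step start  false = ends0
step start  true  = ends1
step ends1  false = ends0
step ends1  true  = dead
step ends0  false = ends00
step ends0  true  = ends1
step ends00 false = dead
step ends00 true  = ends1
step dead   _     = dead

run : ∀ {n} → State → Vec Bool n → State
run s []      = s
run s (b ∷ w) = run (step s b) w

Live : State → Set
Live s = ¬ s ≡ dead

live? : Decidable Live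
live? start  = yes λ ()
live? ends1  = yes λ ()
live? ends0  = yes λ ()
live? ends00 = yes λ ()
live? dead   = no λ live → live refl

run-dead : ∀ {n} (w : Vec Bool n) → run dead w ≡ dead
run-dead []      = refl
run-dead (_ ∷ w) = run-dead w

step-11 : ∀ s → step (step s true) true ≡ dead
step-11 start  = refl
step-11 ends1  = refl
step-11 ends0  = refl
step-11 ends00 = refl
step-11 dead   = refl

step-000 : ∀ s → step (step (step s false) false) false ≡ dead
step-000 start  = refl
step-000 ends1  = refl
step-000 ends0  = refl
step-000 ends00 = refl
step-000 dead   = refl

-- Positions past the end read as false.
bit : ∀ {n} → Vec Bool n → ℕ → Bool
bit []      _       = false
bit (b ∷ _) zero    = b
bit (_ ∷ w) (suc k) = bit w k

∈⇒bit : ∀ {n} {w : Vec Bool n} {i} → i ∈ w → bit w (toℕ i) ≡ true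
∈⇒bit here      = refl
∈⇒bit (there p) = ∈⇒bit p

∉⇒bit : ∀ {n} {w : Vec Bool n} {i} → i ∉ w → bit w (toℕ i) ≡ false
∉⇒bit {w = b ∷ _} {fzero}  i∉w with b
... | true  = contradiction here i∉w
... | false = refl
∉⇒bit {w = _ ∷ _} {fsuc i} i∉w = ∉⇒bit (i∉w ∘ there)

bit⇒∈ : ∀ {n} {w : Vec Bool n} k → bit w k ≡ true → ∃[ i ] (i ∈ w × toℕ i ≡ k)
bit⇒∈ {w = _ ∷ _} zero    refl = fzero , here , refl
bit⇒∈ {w = _ ∷ _} (suc k) b≡t with bit⇒∈ k b≡t
... | i , i∈w , i≡k = fsuc i , there i∈w , cong suc i≡k

bit-++ˡ : ∀ {m n} (w : Vec Bool m) {v : Vec Bool n} {k} → k < m → bit (w ++ v) k ≡ bit w k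
bit-++ˡ (_ ∷ _) {k = zero}  _         = refl
bit-++ˡ (_ ∷ w) {k = suc k} (s≤s k<m) = bit-++ˡ w k<m

bit-++ʳ : ∀ {m n} (w : Vec Bool m) {v : Vec Bool n} k → bit (w ++ v) (k + m) ≡ bit v k
bit-++ʳ []      k rewrite +-identityʳ k = refl
bit-++ʳ {suc m} (_ ∷ w) k rewrite +-suc k m = bit-++ʳ w k

run-11 : ∀ {n} s (w : Vec Bool n) k → bit w k ≡ true → bit w (suc k) ≡ true → run s w ≡ dead
run-11 s (true ∷ true ∷ w) zero    refl refl = trans (cong (λ t → run t w) (step-11 s)) (run-dead w)
run-11 s (b ∷ w)           (suc k) p q       = run-11 (step s b) w k p q

run-000 : ∀ {n} s (w : Vec Bool n) k → 2 + k < n →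
          bit w k ≡ false → bit w (1 + k) ≡ false → bit w (2 + k) ≡ false → run s w ≡ dead
run-000 s (false ∷ false ∷ false ∷ w) zero    _         refl refl refl =
  trans (cong (λ t → run t w) (step-000 s)) (run-dead w)
run-000 s (_ ∷ _ ∷ [])                zero    (s≤s (s≤s ())) _ _ _
run-000 s (b ∷ w)                     (suc k) (s≤s k<n) p    q    r    = run-000 (step s b) w k k<n p q r

live⇒neighbour : ∀ {n} s (w : Vec Bool n) k → Live (run s w) → 2 + k < n →
                 bit w (1 + k) ≡ false → bit w k ≡ true ⊎ bit w (2 + k) ≡ true
live⇒neighbour s w k live k<n mid with bit w k in left | bit w (2 + k) in right
... | true  | _     = inj₁ refl
... | false | true  = inj₂ refl
... | false | false = contradiction (run-000 s w k k<n left mid right) live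

-- Reading the first two letters again after the word turns the cyclic factors 11 and
-- 000 into ordinary ones.
CyclicallyLive : ∀ {n} → Vec Bool n → Set
CyclicallyLive (b₀ ∷ b₁ ∷ w) = Live (run start (b₀ ∷ b₁ ∷ w ++ b₀ ∷ b₁ ∷ []))
CyclicallyLive _             = ⊥

cyclicallyLive? : ∀ {n} → Decidable (CyclicallyLive {n})
cyclicallyLive? []            = no λ ()
cyclicallyLive? (_ ∷ [])      = no λ ()
cyclicallyLive? (_ ∷ _ ∷ _)   = live? _

module _ {n} (b₀ b₁ : Bool) (w : Vec Bool n) where
  private
    W : Vec Bool (2 + n)
    W = b₀ ∷ b₁ ∷ w

    u : Vec Bool (2 + n + 2)
    u = W ++ b₀ ∷ b₁ ∷ []

    2+k<∣u∣ : ∀ {k} → k ≤ 1 + n → 2 + k < 2 + n + 2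
    2+k<∣u∣ k≤1+n = s≤s (s≤s (≤-trans (s≤s k≤1+n) (≤-reflexive (+-comm 2 n))))

    member-bit : ∀ {i} → i ∈ W → bit u (toℕ i) ≡ true
    member-bit {i} i∈W = trans (bit-++ˡ W (toℕ<n i)) (∈⇒bit i∈W)

    bit-member : ∀ {k} → k < 2 + n → bit u k ≡ true → ∃[ j ] (j ∈ W × toℕ j ≡ k)
    bit-member {k} k<2+n uₖ = bit⇒∈ k (trans (sym (bit-++ˡ W k<2+n)) uₖ)

    wrapped-bit-member : ∀ {k} → k < 2 → bit u (k + (2 + n)) ≡ true → ∃[ j ] (j ∈ W × toℕ j ≡ k)
    wrapped-bit-member {k} k<2 uₖ =
      bit⇒∈ k (trans (bit-++ˡ (b₀ ∷ b₁ ∷ []) k<2) (trans (sym (bit-++ʳ W k)) uₖ))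

  cyclicallyLive⇒maximalIndependent : CyclicallyLive W → MaximalIndependent (C (2 + n)) W
  cyclicallyLive⇒maximalIndependent live = independent , dominating
    where
    no-consecutive-members : ∀ {i j} → i ∈ W → j ∈ W →
      toℕ j ≡ suc (toℕ i) ⊎ (toℕ i ≡ 0 × toℕ j ≡ 1 + n) → ⊥
    no-consecutive-members {i} {j} i∈W j∈W (inj₁ j≡1+i) =
      live (run-11 start u (toℕ i) (member-bit i∈W)
                   (subst (λ k → bit u k ≡ true) j≡1+i (member-bit j∈W)))
    no-consecutive-members {i} {j} i∈W j∈W (inj₂ (i≡0 , j≡1+n)) =
      live (run-11 start u (1 + n)
                   (subst (λ k → bit u k ≡ true) j≡1+n (member-bit j∈W))
                   (trans (bit-++ʳ W 0) (subst (λ k → bit W k ≡ true) i≡0 (∈⇒bit i∈W))))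

    independent : Independent (C (2 + n)) W
    independent _ _ i∈W j∈W (inj₁ adj)               = no-consecutive-members i∈W j∈W (inj₁ adj)
    independent _ _ i∈W j∈W (inj₂ (inj₁ adj))        = no-consecutive-members j∈W i∈W (inj₁ adj)
    independent _ _ i∈W j∈W (inj₂ (inj₂ (inj₁ adj))) = no-consecutive-members i∈W j∈W (inj₂ adj)
    independent _ _ i∈W j∈W (inj₂ (inj₂ (inj₂ adj))) = no-consecutive-members j∈W i∈W (inj₂ adj)

    -- The cyclic window around v starts in u at toℕ v ∸ 1, or at 1 + n for v = 0.
    dominating : ∀ v → v ∉ W → ∃[ j ] (j ∈ W × CycleAdj (2 + n) v j)
    dominating fzero v∉W
      with live⇒neighbour start u (1 + n) live (2+k<∣u∣ ≤-refl) (trans (bit-++ʳ W 0) (∉⇒bit v∉W))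
    ... | inj₁ last with bit-member ≤-refl last
    ...   | j , j∈W , j≡1+n = j , j∈W , inj₂ (inj₂ (inj₁ (refl , j≡1+n)))
    dominating fzero v∉W | inj₂ second with wrapped-bit-member (s≤s (s≤s z≤n)) second
    ...   | j , j∈W , j≡1 = j , j∈W , inj₁ j≡1
    dominating (fsuc v) v∉W
      with live⇒neighbour start u (toℕ v) live (2+k<∣u∣ (<⇒≤ (toℕ<n v)))
             (trans (bit-++ˡ W (toℕ<n (fsuc v))) (∉⇒bit v∉W))
    ... | inj₁ left with bit-member (≤-trans (toℕ<n v) (n≤1+n _)) left
    ...   | j , j∈W , j≡v = j , j∈W , inj₂ (inj₁ (cong suc (sym j≡v)))
    dominating (fsuc v) v∉W | inj₂ right with toℕ v ≟ n
    ...   | no v≢n with bit-member (s≤s (s≤s (≤∧≢⇒< (≤-pred (toℕ<n v)) v≢n))) right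
    ...     | j , j∈W , j≡2+v = j , j∈W , inj₁ j≡2+v
    dominating (fsuc v) v∉W | inj₂ right | yes v≡n
      with wrapped-bit-member (s≤s z≤n) (subst (λ k → bit u (2 + k) ≡ true) v≡n right)
    ...     | j , j∈W , j≡0 = j , j∈W , inj₂ (inj₂ (inj₂ (j≡0 , cong suc v≡n)))

length-filter-extensions : ∀ {p n} {P : Pred (Vec Bool (suc n)) p} (P? : Decidable P)
                           (xs : List (Vec Bool n)) →
  length (filter P? (concatMap (λ w → (false ∷ w) ∷ˡ (true ∷ w) ∷ˡ []ˡ) xs))
  ≡ length (filter (P? ∘ (false ∷_)) xs) + length (filter (P? ∘ (true ∷_)) xs)
length-filter-extensions P? []ˡ = refl
length-filter-extensions P? (w ∷ˡ xs) with does (P? (false ∷ w))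
... | false with does (P? (true ∷ w))
...   | false = length-filter-extensions P? xs
...   | true  = trans (cong suc (length-filter-extensions P? xs)) (sym (+-suc _ _))
length-filter-extensions P? (w ∷ˡ xs) | true with does (P? (true ∷ w))
...   | false = cong suc (length-filter-extensions P? xs)
...   | true  = cong suc (trans (cong suc (length-filter-extensions P? xs)) (sym (+-suc _ _)))

cyclicWords : ℕ → ℕ
cyclicWords n = length (filter cyclicallyLive? (allSubsets n))

cyclicWords≤mis : ∀ n → cyclicWords (2 + n) ≤ mis (C (2 + n))
cyclicWords≤mis n = length-mono-≤ (filter⁺ cyclicallyLive? (maximalIndependent? (C (2 + n)))
  (λ { {b₀ ∷ b₁ ∷ w} refl → cyclicallyLive⇒maximalIndependent b₀ b₁ w })
  (⊆-refl {x = allSubsets (2 + n)}))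

record Recurrent (a : ℕ → ℕ) : Set where
  constructor recurrent
  field recurrence : ∀ k → a (3 + k) ≡ a (1 + k) + a k

open Recurrent

recurrent-+ : ∀ {a b} → Recurrent a → Recurrent b → Recurrent (λ n → a n + b n)
recurrent-+ {a} {b} ra rb = recurrent λ k →
  trans (cong₂ _+_ (recurrence ra k) (recurrence rb k))
        (interchange (a (1 + k)) (a k) (b (1 + k)) (b k))

recurrent-shift : ∀ {a} m → Recurrent a → Recurrent (λ n → a (m + n))
recurrent-shift zero    ra = ra
recurrent-shift {a} (suc m) ra = recurrent-shift {λ n → a (suc n)} m (recurrent (recurrence ra ∘ suc))

recurrent-resp-≗ : ∀ {a b} → a ≗ b → Recurrent a → Recurrent b
recurrent-resp-≗ {a} {b} a≗b ra = recurrent λ k →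
  trans (sym (a≗b (3 + k))) (trans (recurrence ra k) (cong₂ _+_ (a≗b (1 + k)) (a≗b k)))

recurrent-mono : ∀ {a} → Recurrent a → ∀ k → a (4 + k) ≤ a (5 + k)
recurrent-mono {a} ra k = begin
  a (4 + k)                      ≡⟨ recurrence ra (1 + k) ⟩
  a (2 + k) + a (1 + k)          ≤⟨ +-monoʳ-≤ (a (2 + k)) (m≤m+n (a (1 + k)) (a k)) ⟩
  a (2 + k) + (a (1 + k) + a k)  ≡⟨ +-comm (a (2 + k)) _ ⟩
  (a (1 + k) + a k) + a (2 + k)  ≡⟨ cong (_+ a (2 + k)) (sym (recurrence ra k)) ⟩
  a (3 + k) + a (2 + k)          ≡⟨ sym (recurrence ra (2 + k)) ⟩
  a (5 + k)                      ∎
  where open ≤-Reasoning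

survivors : ∀ {m} → Vec Bool m → State → ℕ → ℕ
survivors v s n = length (filter (λ w → live? (run s (w ++ v))) (allSubsets n))

module _ {m} (v : Vec Bool m) where

  survivors-suc : ∀ s n →
    survivors v s (suc n) ≡ survivors v (step s false) n + survivors v (step s true) n
  survivors-suc s n = length-filter-extensions (λ w → live? (run s (w ++ v))) (allSubsets n)

  survivors-dead : ∀ n → survivors v dead n ≡ 0
  survivors-dead n = cong length (filter-none (λ w → live? (run dead (w ++ v)))
                                   (universal (λ w live → live (run-dead (w ++ v))) (allSubsets n)))

  survivors-ends0 : ∀ n → survivors v ends0 n ≡ survivors v ends1 (suc n)
  survivors-ends0 n = begin
    survivors v ends0 n                       ≡⟨ +-identityʳ _ ⟨
    survivors v ends0 n + 0                   ≡⟨ cong (survivors v ends0 n +_) (survivors-dead n) ⟨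
    survivors v ends0 n + survivors v dead n  ≡⟨ survivors-suc ends1 n ⟨
    survivors v ends1 (suc n)                 ∎
    where open ≡-Reasoning

  survivors-ends00 : ∀ n → survivors v ends00 (suc n) ≡ survivors v ends1 n
  survivors-ends00 n =
    trans (survivors-suc ends00 n) (cong (_+ survivors v ends1 n) (survivors-dead n))

  survivors-recurrent : Recurrent (survivors v ends1)
  survivors-recurrent = recurrent λ k → begin
    survivors v ends1 (3 + k)                               ≡⟨ sym (survivors-ends0 (2 + k)) ⟩
    survivors v ends0 (2 + k)                               ≡⟨ survivors-suc ends0 (1 + k) ⟩
    survivors v ends00 (1 + k) + survivors v ends1 (1 + k)
      ≡⟨ cong (_+ survivors v ends1 (1 + k)) (survivors-ends00 k) ⟩
    survivors v ends1 k + survivors v ends1 (1 + k)         ≡⟨ +-comm (survivors v ends1 k) _ ⟩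
    survivors v ends1 (1 + k) + survivors v ends1 k         ∎
    where open ≡-Reasoning

cyclicWords-split : ∀ n → cyclicWords (3 + n) ≡
  survivors (false ∷ false ∷ []) ends1 n + survivors (false ∷ true ∷ []) ends1 (1 + n)
  + survivors (true ∷ false ∷ []) ends1 (2 + n)
cyclicWords-split n = begin
  cyclicWords (3 + n)
    ≡⟨ trans (length-filter-extensions cyclicallyLive? (allSubsets (2 + n)))
             (cong₂ _+_ (length-filter-extensions _ (allSubsets (1 + n)))
                        (length-filter-extensions _ (allSubsets (1 + n)))) ⟩
  (survivors (false ∷ false ∷ []) ends00 (1 + n) + survivors (false ∷ true ∷ []) ends1 (1 + n))
  + (survivors (true ∷ false ∷ []) ends0 (1 + n) + survivors (true ∷ true ∷ []) dead (1 + n))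
    ≡⟨ cong₂ _+_ (cong (_+ survivors (false ∷ true ∷ []) ends1 (1 + n)) (survivors-ends00 _ n))
                 (trans (cong₂ _+_ (survivors-ends0 _ (1 + n)) (survivors-dead _ (1 + n)))
                        (+-identityʳ _)) ⟩
  survivors (false ∷ false ∷ []) ends1 n + survivors (false ∷ true ∷ []) ends1 (1 + n)
  + survivors (true ∷ false ∷ []) ends1 (2 + n) ∎
  where open ≡-Reasoning

cyclicWords-recurrent : Recurrent (λ n → cyclicWords (3 + n))
cyclicWords-recurrent = recurrent-resp-≗ (sym ∘ cyclicWords-split)
  (recurrent-+ (recurrent-+ (survivors-recurrent (false ∷ false ∷ []))
                            (recurrent-shift 1 (survivors-recurrent (false ∷ true ∷ []))))
               (recurrent-shift 2 (survivors-recurrent (true ∷ false ∷ []))))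

cyclicWords-mono : ∀ m → cyclicWords (5 + m) ≤ cyclicWords (6 + m)
cyclicWords-mono zero          = ≤ᵇ⇒≤ _ _ _
cyclicWords-mono (suc zero)    = ≤ᵇ⇒≤ _ _ _
cyclicWords-mono (suc (suc k)) = recurrent-mono cyclicWords-recurrent k

fib[n]≤fib[1+n] : ∀ n → fib n ≤ fib (suc n)
fib[n]≤fib[1+n] zero    = z≤n
fib[n]≤fib[1+n] (suc n) = m≤m+n (fib (suc n)) (fib n)

fib[n]≤fib[k+n] : ∀ k n → fib n ≤ fib (k + n)
fib[n]≤fib[k+n] zero    n = ≤-refl
fib[n]≤fib[k+n] (suc k) n = ≤-trans (fib[n]≤fib[k+n] k n) (fib[n]≤fib[1+n] (k + n))

[m+n]∸[o+p]≡[m∸o]+[n∸p] : ∀ m n {o p} → o ≤ m → p ≤ n →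
                          (m + n) ∸ (o + p) ≡ (m ∸ o) + (n ∸ p)
[m+n]∸[o+p]≡[m∸o]+[n∸p] m n {o} {p} o≤m p≤n = begin
  (m + n) ∸ (o + p)   ≡⟨ sym (∸-+-assoc (m + n) o p) ⟩
  (m + n) ∸ o ∸ p     ≡⟨ cong (_∸ p) (+-∸-comm n o≤m) ⟩
  (m ∸ o) + n ∸ p     ≡⟨ +-∸-assoc (m ∸ o) p≤n ⟩
  (m ∸ o) + (n ∸ p)   ∎
  where open ≡-Reasoning

ℓ[3+j] : ∀ j → ℓ (3 + j) ≡ fib (5 + j) ∸ fib j
ℓ[3+j] j = cong (λ i → fib (3 + i) ∸ fib j) (+-comm j 2)

ℓ-recurrence : ∀ j → ℓ (5 + j) ≡ ℓ (4 + j) + ℓ (3 + j)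
ℓ-recurrence j = begin
  ℓ (5 + j)
    ≡⟨ ℓ[3+j] (2 + j) ⟩
  (fib (6 + j) + fib (5 + j)) ∸ (fib (1 + j) + fib j)
    ≡⟨ [m+n]∸[o+p]≡[m∸o]+[n∸p] (fib (6 + j)) (fib (5 + j))
         (fib[n]≤fib[k+n] 5 (1 + j)) (fib[n]≤fib[k+n] 5 j) ⟩
  (fib (6 + j) ∸ fib (1 + j)) + (fib (5 + j) ∸ fib j)
    ≡⟨ cong₂ _+_ (ℓ[3+j] (1 + j)) (ℓ[3+j] j) ⟨
  ℓ (4 + j) + ℓ (3 + j)
    ∎
  where open ≡-Reasoning

[k*2+m]/2≡k+m/2 : ∀ k m → (k * 2 + m) / 2 ≡ k + m / 2
[k*2+m]/2≡k+m/2 k m = trans (+-distrib-/-∣ˡ m (divides-refl k)) (cong (_+ m / 2) (m*n/n≡m k 2))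

ℓ≤cyclicWords : ∀ m → ℓ (3 + m / 2) ≤ cyclicWords (5 + m)
ℓ≤cyclicWords 0 = ≤ᵇ⇒≤ _ _ _
ℓ≤cyclicWords 1 = ≤ᵇ⇒≤ _ _ _
ℓ≤cyclicWords 2 = ≤ᵇ⇒≤ _ _ _
ℓ≤cyclicWords 3 = ≤ᵇ⇒≤ _ _ _
ℓ≤cyclicWords (suc (suc (suc (suc m)))) = begin
  ℓ (3 + (4 + m) / 2)
    ≡⟨ cong (λ h → ℓ (3 + h)) ([k*2+m]/2≡k+m/2 2 m) ⟩
  ℓ (5 + m / 2)
    ≡⟨ ℓ-recurrence (m / 2) ⟩
  ℓ (4 + m / 2) + ℓ (3 + m / 2)
    ≡⟨ cong (λ h → ℓ (3 + h) + ℓ (3 + m / 2)) ([k*2+m]/2≡k+m/2 1 m) ⟨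
  ℓ (3 + (2 + m) / 2) + ℓ (3 + m / 2)
    ≤⟨ +-mono-≤ (ℓ≤cyclicWords (suc (suc m)))
                (≤-trans (ℓ≤cyclicWords m) (cyclicWords-mono m)) ⟩
  cyclicWords (7 + m) + cyclicWords (6 + m)
    ≡⟨ recurrence cyclicWords-recurrent (3 + m) ⟨
  cyclicWords (9 + m)
    ∎
  where open ≤-Reasoning

lemma9 : (n : ℕ) → 5 ≤ n → ℓ ((n + 1) / 2) ≤ mis (C n)
lemma9 n 5≤n with m , refl ← m≤n⇒∃[o]m+o≡n 5≤n = begin
  ℓ ((5 + m + 1) / 2)    ≡⟨ cong (λ i → ℓ (i / 2)) (+-comm (5 + m) 1) ⟩
  ℓ ((6 + m) / 2)        ≡⟨ cong ℓ ([k*2+m]/2≡k+m/2 3 m) ⟩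
  ℓ (3 + m / 2)          ≤⟨ ℓ≤cyclicWords m ⟩
  cyclicWords (5 + m)    ≤⟨ cyclicWords≤mis (3 + m) ⟩
  mis (C (5 + m))        ∎
  where open ≤-Reasoning
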